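{- Let $p$ be an odd prime, $g$ a primitive root modulo $p$, $d$ a positive divisor of $p-1$, and $\Gamma=\langle g^d\rangle\le\mathbb{F}_p^\times$. For $0\le i,j,l<d$ let $c_{i,j,l}$ be the number of pairs $(a,b)\in\Gamma\times\Gamma$ with $g^ia+g^jb=g^l$ in $\mathbb{F}_p$, and let $M_{i,j,l}$ be the number of $\mathbb{F}_p$-rational points $(x:y:z)$ in $\mathbb{P}^2(\mathbb{F}_p)$ on the projective curve $g^ix^d+g^jy^d=g^lz^d$. Then $$M_{i,j,l}=d^2c_{i,j,l}+d\,(\delta_{j,l}+\delta_{i,l}+\delta_*),$$ where $\delta_{\cdot,\cdot}$ is the Kronecker delta and $\delta_*=1$ if $\frac{p-1}{2}\equiv i-j\pmod d$ and $\delta_*=0$ otherwise. -}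

module Defs where

open import Data.Nat using (ℕ; zero; suc; _+_; _*_; _∸_; _^_; _<_; NonZero; _≡ᵇ_)
open import Data.Nat.DivMod using (_%_; _/_)
open import Data.Nat.Coprimality using (Coprime)
open import Data.Bool using (Bool; true; false; _∧_; _∨_; not; if_then_else_)
open import Data.List using (List; length; filterᵇ; upTo; cartesianProduct)
open import Data.Bool.ListAction using (any)
open import Data.Product using (_×_; _,_)
open import Relation.Binary.PropositionalEquality using (_≡_; _≢_)

-- Elements of F_p are represented by the residues 0,1,…,p-1 (natural numbers).

IsPrimitiveRoot : (p g : ℕ) → .{{NonZero p}} → Set
IsPrimitiveRoot p g =
  Coprime g p × (∀ k → 0 < k → k < p ∸ 1 → g ^ k % p ≢ 1)

count : {A : Set} → (A → Bool) → List A → ℕ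
count P xs = length (filterᵇ P xs)

-- membership of a residue a in Γ = ⟨g^d⟩ = { (g^d)^k mod p : k ∈ ℕ }.
-- Since the order of g^d divides p-1 < p, it suffices to range over k < p.
inΓ : (p g d : ℕ) → .{{NonZero p}} → ℕ → Bool
inΓ p g d a = any (λ k → a ≡ᵇ ((g ^ d) ^ k) % p) (upTo p)

cCount : (p g d i j l : ℕ) → .{{NonZero p}} → ℕ
cCount p g d i j l =
  count (λ { (a , b) → inΓ p g d a ∧ inΓ p g d b
                       ∧ ((g ^ i * a + g ^ j * b) % p ≡ᵇ (g ^ l) % p) })
        (cartesianProduct (upTo p) (upTo p))

-- canonical representative of a point of P²(F_p): a triple (x,y,z) of residues,
-- not all zero, whose first nonzero coordinate equals 1.
isNormalized : ℕ × ℕ × ℕ → Bool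
isNormalized (x , y , z) with x ≡ᵇ 0 | y ≡ᵇ 0
... | false | _     = x ≡ᵇ 1
... | true  | false = y ≡ᵇ 1
... | true  | true  = z ≡ᵇ 1

MCount : (p g d i j l : ℕ) → .{{NonZero p}} → ℕ
MCount p g d i j l =
  count (λ { (x , y , z) → isNormalized (x , y , z)
                           ∧ ((g ^ i * x ^ d + g ^ j * y ^ d) % p
                                ≡ᵇ (g ^ l * z ^ d) % p) })
        (cartesianProduct (upTo p) (cartesianProduct (upTo p) (upTo p)))

δ : ℕ → ℕ → ℕ
δ i j = if i ≡ᵇ j then 1 else 0

-- δ_* = 1 iff (p-1)/2 ≡ i - j (mod d), for 0 ≤ i < d; written without
-- subtraction as ((p-1)/2 + j) mod d = i.
δ* : (p d i j : ℕ) → .{{NonZero d}} → ℕ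
δ* p d i j = if (((p ∸ 1) / 2 + j) % d) ≡ᵇ i then 1 else 0

{-# OPTIONS --safe #-}
-- Write the nonzero residues as powers g^s with s < p − 1; then Γ = {g^(sd)} and z ↦ z^d
-- is d-to-one from F_p^× onto Γ. A point (1 : y : z) with yz ≠ 0 lies on the curve iff
-- (a, b) = (z^(−d), (y/z)^d) ∈ Γ × Γ solves g^i a + g^j b = g^l, and (y, z) ↦ (a, b) is
-- d²-to-one; this gives d² c. Of the remaining normalised points, (0 : 1 : z) and (1 : 0 : z)
-- need g^l z^d = g^j resp. g^i, which has d solutions if l = j resp. l = i and none otherwise;
-- (1 : y : 0) needs g^j y^d = −g^i = g^(i + (p−1)/2), which has d solutions exactly when
-- (p−1)/2 ≡ i − j (mod d); and (0 : 0 : 1) never lies on the curve.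
module Submission where

open import Defs
open import Data.Bool using (Bool; true; false; T; T?; _∧_; if_then_else_)
open import Data.Bool.ListAction using (any)
open import Data.Empty using (⊥-elim)
open import Data.List using (List; []; _∷_; _++_; map; length; filterᵇ; applyUpTo; upTo; cartesianProduct)
open import Data.List.Properties using (filter-++; length-++)
open import Data.List.Relation.Unary.Any.Properties using (any⁺; any⁻; applyUpTo⁺; applyUpTo⁻)
open import Data.Nat
open import Data.Nat.Divisibility using (_∣_; divides; ∣⇒≤; m%n≡0⇒n∣m; n∣m⇒m%n≡0; ∣-refl)
open import Data.Nat.DivMod
open import Data.Nat.Primality using (Prime; euclidsLemma; prime⇒nonTrivial; prime⇒¬composite; composite-≢)
open import Data.Nat.Properties
open import Data.Nat.Solver using (module +-*-Solver)
open import Data.Product using (_×_; _,_; ∃-syntax; proj₁; proj₂)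
open import Data.Sum using (inj₁; inj₂; [_,_]′)
open import Data.Unit using (tt)
open import Function using (_∘_; id; _⇔_; mk⇔; Equivalence)
open import Relation.Binary.Definitions using (tri<; tri≈; tri>)
open import Relation.Binary.PropositionalEquality
open import Relation.Nullary using (¬_; yes; no)
open +-*-Solver using (solve; _:+_; _:*_; _:=_; con)

⟦_⟧ : Bool → ℕ
⟦ b ⟧ = if b then 1 else 0

T-injective : ∀ {a b} → (T a ⇔ T b) → a ≡ b
T-injective {false} {false} _ = refl
T-injective {false} {true} a⇔b = ⊥-elim (Equivalence.from a⇔b tt)
T-injective {true} {false} a⇔b = ⊥-elim (Equivalence.to a⇔b tt)
T-injective {true} {true} _ = refl

⟦∧⟧ : ∀ a b → ⟦ a ∧ b ⟧ ≡ ⟦ a ⟧ * ⟦ b ⟧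
⟦∧⟧ true b = sym (+-identityʳ ⟦ b ⟧)
⟦∧⟧ false b = refl

≡ᵇ-true : ∀ {x y} → x ≡ y → (x ≡ᵇ y) ≡ true
≡ᵇ-true {x} {y} x≡y = T-injective (mk⇔ (λ _ → tt) (λ _ → ≡⇒≡ᵇ x y x≡y))

≡ᵇ-false : ∀ {x y} → x ≢ y → (x ≡ᵇ y) ≡ false
≡ᵇ-false {x} {y} x≢y = T-injective (mk⇔ (x≢y ∘ ≡ᵇ⇒≡ x y) λ ())

⟦≡ᵇ⟧⇒≡ : ∀ x y → 0 < ⟦ x ≡ᵇ y ⟧ → x ≡ y
⟦≡ᵇ⟧⇒≡ x y pos with x ≡ᵇ y in eq
... | true = ≡ᵇ⇒≡ x y (subst T (sym eq) tt)

≡ᵇ-cong : ∀ {x y u v} → (x ≡ y) ⇔ (u ≡ v) → (x ≡ᵇ y) ≡ (u ≡ᵇ v)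
≡ᵇ-cong {x} {y} {u} {v} x≡y⇔u≡v = T-injective (mk⇔
  (≡⇒≡ᵇ u v ∘ Equivalence.to x≡y⇔u≡v ∘ ≡ᵇ⇒≡ x y)
  (≡⇒≡ᵇ x y ∘ Equivalence.from x≡y⇔u≡v ∘ ≡ᵇ⇒≡ u v))

≡ᵇ-sym : ∀ x y → (x ≡ᵇ y) ≡ (y ≡ᵇ x)
≡ᵇ-sym x y = ≡ᵇ-cong {x} {y} {y} {x} (mk⇔ sym sym)

-- Finite sums

∑ : ℕ → (ℕ → ℕ) → ℕ
∑ zero f = 0
∑ (suc n) f = f 0 + ∑ n (f ∘ suc)

syntax ∑ n (λ k → e) = ∑[ k < n ] e

∑-cong : ∀ n {f h : ℕ → ℕ} → (∀ k → k < n → f k ≡ h k) → ∑ n f ≡ ∑ n h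
∑-cong zero eq = refl
∑-cong (suc n) eq = cong₂ _+_ (eq 0 z<s) (∑-cong n (λ k k<n → eq (suc k) (s<s k<n)))

∑-zero : ∀ n {f : ℕ → ℕ} → (∀ k → k < n → f k ≡ 0) → ∑ n f ≡ 0
∑-zero zero eq = refl
∑-zero (suc n) eq = cong₂ _+_ (eq 0 z<s) (∑-zero n (λ k k<n → eq (suc k) (s<s k<n)))

∑-const : ∀ n c → ∑[ _ < n ] c ≡ n * c
∑-const zero c = refl
∑-const (suc n) c = cong (c +_) (∑-const n c)

∑-distrib-+ : ∀ n (f h : ℕ → ℕ) → ∑[ k < n ] (f k + h k) ≡ ∑ n f + ∑ n h
∑-distrib-+ zero f h = refl
∑-distrib-+ (suc n) f h = begin
    (f 0 + h 0) + ∑[ k < n ] (f (suc k) + h (suc k))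
  ≡⟨ cong ((f 0 + h 0) +_) (∑-distrib-+ n (f ∘ suc) (h ∘ suc)) ⟩
    (f 0 + h 0) + (∑ n (f ∘ suc) + ∑ n (h ∘ suc))
  ≡⟨ +-*-Solver.solve 4 (λ a b c e → (a :+ b) :+ (c :+ e) := (a :+ c) :+ (b :+ e)) refl (f 0) (h 0) _ _ ⟩
    (f 0 + ∑ n (f ∘ suc)) + (h 0 + ∑ n (h ∘ suc))
  ∎
  where open ≡-Reasoning

∑-distribˡ-* : ∀ n c (f : ℕ → ℕ) → ∑[ k < n ] (c * f k) ≡ c * ∑ n f
∑-distribˡ-* zero c f = sym (*-zeroʳ c)
∑-distribˡ-* (suc n) c f =
  trans (cong (c * f 0 +_) (∑-distribˡ-* n c (f ∘ suc))) (sym (*-distribˡ-+ c (f 0) _))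

∑-distribʳ-* : ∀ n c (f : ℕ → ℕ) → ∑[ k < n ] (f k * c) ≡ ∑ n f * c
∑-distribʳ-* n c f =
  trans (∑-cong n (λ k _ → *-comm (f k) c)) (trans (∑-distribˡ-* n c f) (*-comm c _))

∑-comm : ∀ n m (f : ℕ → ℕ → ℕ) → ∑[ a < n ] ∑[ b < m ] f a b ≡ ∑[ b < m ] ∑[ a < n ] f a b
∑-comm zero m f = sym (∑-zero m (λ _ _ → refl))
∑-comm (suc n) m f = begin
    ∑ m (f 0) + ∑[ a < n ] ∑[ b < m ] f (suc a) b
  ≡⟨ cong (∑ m (f 0) +_) (∑-comm n m (f ∘ suc)) ⟩
    ∑ m (f 0) + ∑[ b < m ] ∑[ a < n ] f (suc a) b
  ≡⟨ sym (∑-distrib-+ m (f 0) _) ⟩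
    ∑[ b < m ] (f 0 b + ∑[ a < n ] f (suc a) b)
  ∎
  where open ≡-Reasoning

∑-sucʳ : ∀ n (f : ℕ → ℕ) → ∑ (suc n) f ≡ ∑ n f + f n
∑-sucʳ zero f = +-comm (f 0) 0
∑-sucʳ (suc n) f = trans (cong (f 0 +_) (∑-sucʳ n (f ∘ suc))) (sym (+-assoc (f 0) _ _))

∑-split-+ : ∀ m n (f : ℕ → ℕ) → ∑ (m + n) f ≡ ∑ m f + ∑[ k < n ] f (m + k)
∑-split-+ zero n f = refl
∑-split-+ (suc m) n f =
  trans (cong (f 0 +_) (∑-split-+ m n (f ∘ suc))) (sym (+-assoc (f 0) _ _))

∑-split-* : ∀ a b (f : ℕ → ℕ) → ∑ (a * b) f ≡ ∑[ q < a ] ∑[ r < b ] f (q * b + r)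
∑-split-* zero b f = refl
∑-split-* (suc a) b f = begin
    ∑ (b + a * b) f
  ≡⟨ ∑-split-+ b (a * b) f ⟩
    ∑ b f + ∑[ k < a * b ] f (b + k)
  ≡⟨ cong (∑ b f +_) (∑-split-* a b (λ k → f (b + k))) ⟩
    ∑ b f + ∑[ q < a ] ∑[ r < b ] f (b + (q * b + r))
  ≡⟨ cong (∑ b f +_) (∑-cong a λ q _ → ∑-cong b λ r _ → cong f (sym (+-assoc b (q * b) r))) ⟩
    ∑ b f + ∑[ q < a ] ∑[ r < b ] f (suc q * b + r)
  ∎
  where open ≡-Reasoning

∑-select : ∀ n c (f : ℕ → ℕ) → c < n → ∑[ k < n ] (⟦ c ≡ᵇ k ⟧ * f k) ≡ f c
∑-select (suc n) zero f _ =
  trans (cong (f 0 + 0 +_) (∑-zero n (λ _ _ → refl))) (trans (+-identityʳ _) (+-identityʳ _))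
∑-select (suc n) (suc c) f (s<s c<n) = ∑-select n c (f ∘ suc) c<n

∑-count-≡ : ∀ n c → c < n → ∑[ k < n ] ⟦ c ≡ᵇ k ⟧ ≡ 1
∑-count-≡ n c c<n = trans (∑-cong n (λ k _ → sym (*-identityʳ _))) (∑-select n c (λ _ → 1) c<n)

∑-pos : ∀ n (f : ℕ → ℕ) → 0 < ∑ n f → ∃[ k ] k < n × 0 < f k
∑-pos (suc n) f pos with f 0 in eq
... | suc _ = 0 , z<s , subst (0 <_) (sym eq) z<s
... | zero with ∑-pos n (f ∘ suc) pos
...   | k , k<n , fk>0 = suc k , s<s k<n , fk>0

∑-≤ : ∀ n (f : ℕ → ℕ) → (∀ k → k < n → f k ≤ 1) → ∑ n f ≤ n
∑-≤ zero f _ = z≤n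
∑-≤ (suc n) f f≤1 = +-mono-≤ (f≤1 0 z<s) (∑-≤ n (f ∘ suc) (λ k k<n → f≤1 (suc k) (s<s k<n)))

∑-first-two : ∀ {m} (f : ℕ → ℕ) → 1 < m → (∀ k → f (2 + k) ≡ 0) → ∑ m f ≡ f 0 + f 1
∑-first-two {suc (suc m)} f (s<s (s<s _)) f[2+k]≡0 =
  cong (f 0 +_) (trans (cong (f 1 +_) (∑-zero m (λ k _ → f[2+k]≡0 k))) (+-identityʳ (f 1)))

≤1-∑≡n⇒≡1 : ∀ n (f : ℕ → ℕ) → (∀ k → k < n → f k ≤ 1) → ∑ n f ≡ n → ∀ k → k < n → f k ≡ 1
≤1-∑≡n⇒≡1 (suc n) f f≤1 ∑≡ k k<n = go k k<n
  where
  f∘suc≤1 : ∀ k → k < n → f (suc k) ≤ 1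
  f∘suc≤1 k k<n = f≤1 (suc k) (s<s k<n)
  split : ∀ {x y} → x ≤ 1 → y ≤ n → x + y ≡ suc n → x ≡ 1 × y ≡ n
  split {0} _ y≤n x+y≡ = ⊥-elim (1+n≰n (subst (_≤ n) x+y≡ y≤n))
  split {1} _ _ x+y≡ = refl , suc-injective x+y≡
  split {suc (suc _)} (s≤s ())
  f0≡1×rest≡n : f 0 ≡ 1 × ∑ n (f ∘ suc) ≡ n
  f0≡1×rest≡n = split (f≤1 0 z<s) (∑-≤ n (f ∘ suc) f∘suc≤1) ∑≡
  go : ∀ k → k < suc n → f k ≡ 1
  go zero _ = proj₁ f0≡1×rest≡n
  go (suc k) (s<s k<n) = ≤1-∑≡n⇒≡1 n (f ∘ suc) f∘suc≤1 (proj₂ f0≡1×rest≡n) k k<n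

∑-unique≤1 : ∀ n (f : ℕ → ℕ) a →
             (∀ k k' → k < n → k' < n → f k ≡ a → f k' ≡ a → k ≡ k') →
             ∑[ k < n ] ⟦ f k ≡ᵇ a ⟧ ≤ 1
∑-unique≤1 zero f a _ = z≤n
∑-unique≤1 (suc n) f a uniq with f 0 ≟ a
... | no f0≢a rewrite ≡ᵇ-false f0≢a =
  ∑-unique≤1 n (f ∘ suc) a (λ k k' k<n k'<n fk≡a fk'≡a →
    suc-injective (uniq (suc k) (suc k') (s<s k<n) (s<s k'<n) fk≡a fk'≡a))
... | yes f0≡a = ≤-reflexive (cong₂ _+_ (cong ⟦_⟧ (≡ᵇ-true f0≡a)) (∑-zero n f[1+k]≢a))
  where
  f[1+k]≢a : ∀ k → k < n → ⟦ f (suc k) ≡ᵇ a ⟧ ≡ 0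
  f[1+k]≢a k k<n = cong ⟦_⟧ (≡ᵇ-false (λ fk≡a → 0≢1+n (uniq 0 (suc k) z<s (s<s k<n) f0≡a fk≡a)))

module Injection {n : ℕ} {φ : ℕ → ℕ} (φ< : ∀ {k} → k < n → φ k < n)
                 (φ-inj : ∀ {k k'} → k < n → k' < n → φ k ≡ φ k' → k ≡ k') where

  fiber : ℕ → ℕ
  fiber a = ∑[ k < n ] ⟦ φ k ≡ᵇ a ⟧

  ∑-fiber : ∑ n fiber ≡ n
  ∑-fiber = begin
      ∑[ a < n ] ∑[ k < n ] ⟦ φ k ≡ᵇ a ⟧
    ≡⟨ ∑-comm n n _ ⟩
      ∑[ k < n ] ∑[ a < n ] ⟦ φ k ≡ᵇ a ⟧
    ≡⟨ ∑-cong n (λ k k<n → ∑-count-≡ n (φ k) (φ< k<n)) ⟩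
      ∑[ k < n ] 1
    ≡⟨ trans (∑-const n 1) (*-identityʳ n) ⟩
      n
    ∎
    where open ≡-Reasoning

  fiber≡1 : ∀ a → a < n → fiber a ≡ 1
  fiber≡1 = ≤1-∑≡n⇒≡1 n fiber fiber≤1 ∑-fiber
    where
    fiber≤1 : ∀ a → a < n → fiber a ≤ 1
    fiber≤1 a _ = ∑-unique≤1 n φ a (λ k k' k<n k'<n φk≡a φk'≡a → φ-inj k<n k'<n (trans φk≡a (sym φk'≡a)))

  surjective : ∀ a → a < n → ∃[ k ] k < n × φ k ≡ a
  surjective a a<n with ∑-pos n (λ k → ⟦ φ k ≡ᵇ a ⟧) (subst (0 <_) (sym (fiber≡1 a a<n)) z<s)
  ... | k , k<n , pos = k , k<n , ⟦≡ᵇ⟧⇒≡ (φ k) a pos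

  ∑-reindex : ∀ (F : ℕ → ℕ) → ∑[ k < n ] F (φ k) ≡ ∑ n F
  ∑-reindex F = begin
      ∑[ k < n ] F (φ k)
    ≡⟨ ∑-cong n (λ k k<n → sym (∑-select n (φ k) F (φ< k<n))) ⟩
      ∑[ k < n ] ∑[ a < n ] (⟦ φ k ≡ᵇ a ⟧ * F a)
    ≡⟨ ∑-comm n n _ ⟩
      ∑[ a < n ] ∑[ k < n ] (⟦ φ k ≡ᵇ a ⟧ * F a)
    ≡⟨ ∑-cong n (λ a a<n → trans (∑-distribʳ-* n (F a) _) (cong (_* F a) (fiber≡1 a a<n))) ⟩
      ∑[ a < n ] (1 * F a)
    ≡⟨ ∑-cong n (λ a _ → *-identityˡ (F a)) ⟩
      ∑ n F
    ∎
    where open ≡-Reasoning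

Periodic : ℕ → (ℕ → ℕ) → Set
Periodic n f = ∀ k → f (k + n) ≡ f k

periodic-* : ∀ {n f} → Periodic n f → ∀ k q → f (k + q * n) ≡ f k
periodic-* {f = f} per k zero = cong f (+-identityʳ k)
periodic-* {n} {f} per k (suc q) =
  trans (cong f (solve 3 (λ k n q → k :+ (n :+ q :* n) := (k :+ q :* n) :+ n) refl k n q))
        (trans (per (k + q * n)) (periodic-* per k q))

∑-rotate₁ : ∀ n (f : ℕ → ℕ) → f n ≡ f 0 → ∑[ k < n ] f (suc k) ≡ ∑ n f
∑-rotate₁ n f fn≡f0 = +-cancelˡ-≡ (f 0) _ _
  (trans (∑-sucʳ n f) (trans (cong (∑ n f +_) fn≡f0) (+-comm (∑ n f) (f 0))))

∑-rotate : ∀ n (f : ℕ → ℕ) → Periodic n f → ∀ c → ∑[ k < n ] f (k + c) ≡ ∑ n f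
∑-rotate n f per zero = ∑-cong n (λ k _ → cong f (+-identityʳ k))
∑-rotate n f per (suc c) = begin
    ∑[ k < n ] f (k + suc c)
  ≡⟨ ∑-cong n (λ k _ → cong f (+-suc k c)) ⟩
    ∑[ k < n ] f (suc k + c)
  ≡⟨ ∑-rotate₁ n (λ k → f (k + c)) (trans (cong f (+-comm n c)) (per c)) ⟩
    ∑[ k < n ] f (k + c)
  ≡⟨ ∑-rotate n f per c ⟩
    ∑ n f
  ∎
  where open ≡-Reasoning

∑-reverse : ∀ n (f : ℕ → ℕ) → ∑[ k < n ] f (n ∸ suc k) ≡ ∑ n f
∑-reverse zero f = refl
∑-reverse (suc n) f =
  trans (cong (f n +_) (∑-reverse n f)) (trans (+-comm (f n) _) (sym (∑-sucʳ n f)))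

∑-reflect : ∀ n (f : ℕ → ℕ) → Periodic n f → ∑[ k < n ] f (n ∸ k) ≡ ∑ n f
∑-reflect n f per = begin
    ∑[ k < n ] f (n ∸ k)
  ≡⟨ ∑-cong n (λ k k<n → cong f (+-∸-assoc 1 k<n)) ⟩
    ∑[ k < n ] f (suc (n ∸ suc k))
  ≡⟨ ∑-reverse n (f ∘ suc) ⟩
    ∑[ k < n ] f (suc k)
  ≡⟨ ∑-rotate₁ n f (per 0) ⟩
    ∑ n f
  ∎
  where open ≡-Reasoning

-- Counting in lists

count-∷ : {A : Set} (P : A → Bool) (x : A) (xs : List A) → count P (x ∷ xs) ≡ ⟦ P x ⟧ + count P xs
count-∷ P x xs with P x
... | true = refl
... | false = refl

count-++ : {A : Set} (P : A → Bool) (xs ys : List A) → count P (xs ++ ys) ≡ count P xs + count P ys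
count-++ P xs ys = trans (cong length (filter-++ (T? ∘ P) xs ys)) (length-++ (filterᵇ P xs))

count-map : {A B : Set} (P : B → Bool) (f : A → B) (xs : List A) → count P (map f xs) ≡ count (P ∘ f) xs
count-map P f [] = refl
count-map P f (x ∷ xs) =
  trans (count-∷ P (f x) (map f xs))
        (trans (cong (⟦ P (f x) ⟧ +_) (count-map P f xs)) (sym (count-∷ (P ∘ f) x xs)))

count-applyUpTo : {A : Set} (P : A → Bool) (f : ℕ → A) (n : ℕ) → count P (applyUpTo f n) ≡ ∑[ k < n ] ⟦ P (f k) ⟧
count-applyUpTo P f zero = refl
count-applyUpTo P f (suc n) =
  trans (count-∷ P (f 0) _) (cong (⟦ P (f 0) ⟧ +_) (count-applyUpTo P (f ∘ suc) n))

count-cartesianProduct : {A B : Set} (P : A × B → Bool) (f : ℕ → A) (n : ℕ) (ys : List B) →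
  count P (cartesianProduct (applyUpTo f n) ys) ≡ ∑[ k < n ] count (λ y → P (f k , y)) ys
count-cartesianProduct P f zero ys = refl
count-cartesianProduct P f (suc n) ys =
  trans (count-++ P (map (f 0 ,_) ys) _)
        (cong₂ _+_ (count-map P (f 0 ,_) ys) (count-cartesianProduct P (f ∘ suc) n ys))

0^n≡0 : ∀ n .{{_ : NonZero n}} → 0 ^ n ≡ 0
0^n≡0 (suc _) = refl

[1+m]*[m∸1]≡m*m∸1 : ∀ m → (1 + m) * (m ∸ 1) ≡ m * m ∸ 1
[1+m]*[m∸1]≡m*m∸1 zero = refl
[1+m]*[m∸1]≡m*m∸1 (suc m) = solve 1 (λ m → (con 2 :+ m) :* m := m :+ m :* (con 1 :+ m)) refl m

-- Arithmetic modulo p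

module Congruence (p : ℕ) .{{_ : NonZero p}} where

  infix 4 _≈_
  _≈_ : ℕ → ℕ → Set
  a ≈ b = a % p ≡ b % p

  infix 4 _≈ᵇ_
  _≈ᵇ_ : ℕ → ℕ → Bool
  a ≈ᵇ b = a % p ≡ᵇ b % p

  ≈ᵇ-cong : ∀ {a a' b b'} → a ≈ a' → b ≈ b' → (a ≈ᵇ b) ≡ (a' ≈ᵇ b')
  ≈ᵇ-cong = cong₂ _≡ᵇ_

  ≈-+ : ∀ {a a' b b'} → a ≈ a' → b ≈ b' → a + b ≈ a' + b'
  ≈-+ {a} {a'} {b} {b'} a≈a' b≈b' =
    trans (%-distribˡ-+ a b p) (trans (cong₂ (λ x y → (x + y) % p) a≈a' b≈b') (sym (%-distribˡ-+ a' b' p)))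

  ≈-* : ∀ {a a' b b'} → a ≈ a' → b ≈ b' → a * b ≈ a' * b'
  ≈-* {a} {a'} {b} {b'} a≈a' b≈b' =
    trans (%-distribˡ-* a b p) (trans (cong₂ (λ x y → (x * y) % p) a≈a' b≈b') (sym (%-distribˡ-* a' b' p)))

  ≈-*ˡ : ∀ c {b b'} → b ≈ b' → c * b ≈ c * b'
  ≈-*ˡ c = ≈-* {c} refl

  ≈-^ : ∀ {a b} k → a ≈ b → a ^ k ≈ b ^ k
  ≈-^ zero _ = refl
  ≈-^ (suc k) a≈b = ≈-* a≈b (≈-^ k a≈b)

  %-≈ : ∀ a → a % p ≈ a
  %-≈ a = m%n%n≡m%n a p

  ≈⇒∣∸ : ∀ {a b} → b ≤ a → a ≈ b → p ∣ a ∸ b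
  ≈⇒∣∸ {a} {b} b≤a a≈b = divides (a / p ∸ b / p) (begin
      a ∸ b
    ≡⟨ cong₂ _∸_ (m≡m%n+[m/n]*n a p) (m≡m%n+[m/n]*n b p) ⟩
      (a % p + a / p * p) ∸ (b % p + b / p * p)
    ≡⟨ cong (λ x → (a % p + a / p * p) ∸ (x + b / p * p)) (sym a≈b) ⟩
      (a % p + a / p * p) ∸ (a % p + b / p * p)
    ≡⟨ [m+n]∸[m+o]≡n∸o (a % p) _ _ ⟩
      a / p * p ∸ b / p * p
    ≡⟨ sym (*-distribʳ-∸ p (a / p) (b / p)) ⟩
      (a / p ∸ b / p) * p
    ∎)
    where open ≡-Reasoning

  ∣∸⇒≈ : ∀ {a b} → b ≤ a → p ∣ a ∸ b → a ≈ b
  ∣∸⇒≈ {a} {b} b≤a p∣a∸b = trans (cong (_% p) (sym (m+[n∸m]≡n b≤a))) (%-remove-+ʳ b p∣a∸b)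

  ≈0⇒∣ : ∀ {a} → a ≈ 0 → p ∣ a
  ≈0⇒∣ {a} a≈0 = m%n≡0⇒n∣m a p (trans a≈0 (m*n%n≡0 0 p))

  ∣⇒≈0 : ∀ {a} → p ∣ a → a ≈ 0
  ∣⇒≈0 {a} p∣a = trans (n∣m⇒m%n≡0 a p p∣a) (sym (m*n%n≡0 0 p))

  ≈-by-≤ : {R : ℕ → ℕ → Set} → (∀ {x y} → R x y → R y x) →
           (∀ {x y} → y ≤ x → R x y → x ≈ y) → ∀ {a b} → R a b → a ≈ b
  ≈-by-≤ R-sym R⇒≈ {a} {b} r with ≤-total b a
  ... | inj₁ b≤a = R⇒≈ b≤a r
  ... | inj₂ a≤b = sym (R⇒≈ a≤b (R-sym r))

  ≈-cancelˡ-+ : ∀ c {a b} → c + a ≈ c + b → a ≈ b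
  ≈-cancelˡ-+ c = ≈-by-≤ sym λ {x} {y} y≤x cx≈cy →
    ∣∸⇒≈ y≤x (subst (p ∣_) ([m+n]∸[m+o]≡n∸o c x y) (≈⇒∣∸ (+-monoʳ-≤ c y≤x) cx≈cy))

[a+h]%d≡b⇒[h+b]%d≡a : ∀ {d h a b} .{{_ : NonZero d}} → d ∣ h + h → a < d →
                       (a + h) % d ≡ b → (h + b) % d ≡ a
[a+h]%d≡b⇒[h+b]%d≡a {d} {h} {a} {b} (divides k h+h≡kd) a<d [a+h]%d≡b = begin
    (h + b) % d
  ≡⟨ ≈-+ {h} refl (trans (cong (_% d) (sym [a+h]%d≡b)) (%-≈ (a + h))) ⟩
    (h + (a + h)) % d
  ≡⟨ cong (_% d) (trans (solve 2 (λ h a → h :+ (a :+ h) := a :+ (h :+ h)) refl h a) (cong (a +_) h+h≡kd)) ⟩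
    (a + k * d) % d
  ≡⟨ [m+kn]%n≡m%n a k d ⟩
    a % d
  ≡⟨ m<n⇒m%n≡m a<d ⟩
    a
  ∎
  where
  open ≡-Reasoning
  open Congruence d

module PrimeCongruence (p : ℕ) .{{_ : NonZero p}} (isPrime : Prime p) where

  open Congruence p

  ≉0-* : ∀ {a b} → ¬ a ≈ 0 → ¬ b ≈ 0 → ¬ a * b ≈ 0
  ≉0-* {a} {b} a≉0 b≉0 ab≈0 with euclidsLemma a b isPrime (≈0⇒∣ ab≈0)
  ... | inj₁ p∣a = a≉0 (∣⇒≈0 p∣a)
  ... | inj₂ p∣b = b≉0 (∣⇒≈0 p∣b)

  ≈-cancelˡ-* : ∀ c {a b} → ¬ c ≈ 0 → c * a ≈ c * b → a ≈ b
  ≈-cancelˡ-* c c≉0 = ≈-by-≤ sym λ {x} {y} y≤x cx≈cy →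
    [ (λ p∣c → ⊥-elim (c≉0 (∣⇒≈0 p∣c))) , ∣∸⇒≈ y≤x ]′
      (euclidsLemma c (x ∸ y) isPrime (subst (p ∣_) (sym (*-distribˡ-∸ c x y)) (≈⇒∣∸ (*-monoʳ-≤ c y≤x) cx≈cy)))

module PrimitiveRoot (p : ℕ) .{{_ : NonZero p}} (isPrime : Prime p)
                     (g : ℕ) (isPrimitiveRoot : IsPrimitiveRoot p g) where

  open Congruence p
  open PrimeCongruence p isPrime

  n : ℕ
  n = p ∸ 1

  1<p : 1 < p
  1<p = nonTrivial⇒n>1 p {{prime⇒nonTrivial isPrime}}

  p≡1+n : p ≡ suc n
  p≡1+n = sym (m+[n∸m]≡n (<⇒≤ 1<p))

  instance
    n≢0 : NonZero n
    n≢0 = >-nonZero (≤-pred (subst (1 <_) p≡1+n 1<p))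

  1%p≡1 : 1 % p ≡ 1
  1%p≡1 = m<n⇒m%n≡m 1<p

  g^≉0 : ∀ k → ¬ g ^ k ≈ 0
  g^≉0 zero 1≈0 = 0≢1+n (sym (trans (sym 1%p≡1) (trans 1≈0 (m*n%n≡0 0 p))))
  g^≉0 (suc k) = ≉0-* g≉0 (g^≉0 k)
    where
    g≉0 : ¬ g ≈ 0
    g≉0 g≈0 = <-irrefl (sym (proj₁ isPrimitiveRoot (≈0⇒∣ g≈0 , ∣-refl))) 1<p

  g^-+ : ∀ a b → g ^ (a + b) ≡ g ^ a * g ^ b
  g^-+ = ^-distribˡ-+-* g

  g^-cancelˡ : ∀ c {a b} → g ^ c * a ≈ g ^ c * b → a ≈ b
  g^-cancelˡ c = ≈-cancelˡ-* (g ^ c) (g^≉0 c)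

  1≤g^ : ∀ k → 1 ≤ g ^ k
  1≤g^ k with g ^ k in eq
  ... | zero = ⊥-elim (g^≉0 k (cong (_% p) eq))
  ... | suc _ = s≤s z≤n

  g^≉1 : ∀ {k} → 0 < k → k < n → ¬ g ^ k ≈ 1
  g^≉1 0<k k<n g^k≈1 = proj₂ isPrimitiveRoot _ 0<k k<n (trans g^k≈1 1%p≡1)

  g^≈g^⇒g^∸≈1 : ∀ {a b} → a ≤ b → g ^ a ≈ g ^ b → g ^ (b ∸ a) ≈ 1
  g^≈g^⇒g^∸≈1 {a} {b} a≤b g^a≈g^b = sym (g^-cancelˡ a (begin
      g ^ a * 1 % p
    ≡⟨ cong (_% p) (*-identityʳ (g ^ a)) ⟩
      g ^ a % p
    ≡⟨ g^a≈g^b ⟩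
      g ^ b % p
    ≡⟨ cong (λ k → g ^ k % p) (sym (m+[n∸m]≡n a≤b)) ⟩
      g ^ (a + (b ∸ a)) % p
    ≡⟨ cong (_% p) (g^-+ a (b ∸ a)) ⟩
      g ^ a * g ^ (b ∸ a) % p
    ∎))
    where open ≡-Reasoning

  g^-injective : ∀ {a b} → a < n → b < n → g ^ a ≈ g ^ b → a ≡ b
  g^-injective {a} {b} a<n b<n g^a≈g^b with <-cmp a b
  ... | tri< a<b _ _ = ⊥-elim (g^≉1 (m<n⇒0<n∸m a<b) (≤-<-trans (m∸n≤m b a) b<n)
                                     (g^≈g^⇒g^∸≈1 (<⇒≤ a<b) g^a≈g^b))
  ... | tri≈ _ a≡b _ = a≡b
  ... | tri> _ _ b<a = ⊥-elim (g^≉1 (m<n⇒0<n∸m b<a) (≤-<-trans (m∸n≤m a b) a<n)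
                                     (g^≈g^⇒g^∸≈1 (<⇒≤ b<a) (sym g^a≈g^b)))

  1≤g^%p : ∀ k → 1 ≤ g ^ k % p
  1≤g^%p k with g ^ k % p in eq
  ... | zero = ⊥-elim (g^≉0 k (trans eq (sym (m*n%n≡0 0 p))))
  ... | suc _ = s≤s z≤n

  -- k ↦ g ^ k % p maps [0, n) onto [1, p); shifted down by one it injects [0, n) into itself.
  log⁻¹ : ℕ → ℕ
  log⁻¹ k = g ^ k % p ∸ 1

  suc-log⁻¹ : ∀ k → suc (log⁻¹ k) ≡ g ^ k % p
  suc-log⁻¹ k = m+[n∸m]≡n (1≤g^%p k)

  log⁻¹<n : ∀ k → log⁻¹ k < n
  log⁻¹<n k = ∸-monoˡ-< (m%n<n (g ^ k) p) (1≤g^%p k)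

  log⁻¹-injective : ∀ {k k'} → k < n → k' < n → log⁻¹ k ≡ log⁻¹ k' → k ≡ k'
  log⁻¹-injective {k} {k'} k<n k'<n eq =
    g^-injective k<n k'<n (trans (sym (suc-log⁻¹ k)) (trans (cong suc eq) (suc-log⁻¹ k')))

  module Log = Injection {n} {log⁻¹} (λ {k} _ → log⁻¹<n k) log⁻¹-injective

  ∑-units : ∀ (F : ℕ → ℕ) → ∑ p F ≡ F 0 + ∑[ k < n ] F (g ^ k % p)
  ∑-units F = begin
      ∑ p F
    ≡⟨ cong (λ m → ∑ m F) p≡1+n ⟩
      F 0 + ∑ n (F ∘ suc)
    ≡⟨ cong (F 0 +_) (sym (Log.∑-reindex (F ∘ suc))) ⟩
      F 0 + ∑[ k < n ] F (suc (log⁻¹ k))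
    ≡⟨ cong (F 0 +_) (∑-cong n (λ k _ → cong F (suc-log⁻¹ k))) ⟩
      F 0 + ∑[ k < n ] F (g ^ k % p)
    ∎
    where open ≡-Reasoning

  -- g ^ n % p is g ^ k % p for some k < n, and k > 0 would make g ^ (n ∸ k) ≈ 1 too early.
  fermat : g ^ n ≈ 1
  fermat with Log.surjective (log⁻¹ n) (log⁻¹<n n)
  ... | zero , _ , eq = trans (sym (suc-log⁻¹ n)) (trans (cong suc (sym eq)) (suc-log⁻¹ 0))
  ... | suc k , k<n , eq = ⊥-elim (g^≉1 (m<n⇒0<n∸m k<n) (∸-monoʳ-< z<s (<⇒≤ k<n))
          (g^≈g^⇒g^∸≈1 (<⇒≤ k<n) (trans (sym (suc-log⁻¹ (suc k))) (trans (cong suc eq) (suc-log⁻¹ n)))))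

  g^qn≈1 : ∀ q → g ^ (q * n) ≈ 1
  g^qn≈1 zero = refl
  g^qn≈1 (suc q) = trans (cong (_% p) (g^-+ n (q * n))) (≈-* fermat (g^qn≈1 q))

  g^[a+qn]≈g^a : ∀ a q → g ^ (a + q * n) ≈ g ^ a
  g^[a+qn]≈g^a a q = begin
      g ^ (a + q * n) % p
    ≡⟨ cong (_% p) (g^-+ a (q * n)) ⟩
      g ^ a * g ^ (q * n) % p
    ≡⟨ ≈-*ˡ (g ^ a) (g^qn≈1 q) ⟩
      g ^ a * 1 % p
    ≡⟨ cong (_% p) (*-identityʳ (g ^ a)) ⟩
      g ^ a % p
    ∎
    where open ≡-Reasoning

  g^≈g^[%n] : ∀ a → g ^ a ≈ g ^ (a % n)
  g^≈g^[%n] a = trans (cong (λ k → g ^ k % p) (m≡m%n+[m/n]*n a n)) (g^[a+qn]≈g^a (a % n) (a / n))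

  g^≈g^⇔%≡ : ∀ a b → (g ^ a ≈ g ^ b) ⇔ (a % n ≡ b % n)
  g^≈g^⇔%≡ a b = mk⇔
    (λ g^a≈g^b → g^-injective (m%n<n a n) (m%n<n b n)
                   (trans (sym (g^≈g^[%n] a)) (trans g^a≈g^b (g^≈g^[%n] b))))
    (λ a%n≡b%n → trans (g^≈g^[%n] a) (trans (cong (λ k → g ^ k % p) a%n≡b%n) (sym (g^≈g^[%n] b))))

  g^[a+n]≈g^a : ∀ a → g ^ (a + n) ≈ g ^ a
  g^[a+n]≈g^a a = trans (cong (λ k → g ^ (a + k) % p) (sym (+-identityʳ n))) (g^[a+qn]≈g^a a 1)

  module HalfOrder (p≢2 : p ≢ 2) where

    h : ℕ
    h = n / 2

    p%2≡1 : p % 2 ≡ 1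
    p%2≡1 with p % 2 in eq | m%n<n p 2
    ... | 0 | _ = ⊥-elim (prime⇒¬composite isPrime (composite-≢ 2 (p≢2 ∘ sym) (m%n≡0⇒n∣m p 2 eq)))
    ... | 1 | _ = refl
    ... | suc (suc _) | s<s (s<s ())

    n≡h*2 : n ≡ h * 2
    n≡h*2 = trans n≡[p/2]*2 (cong (_* 2) (sym (trans (cong (_/ 2) n≡[p/2]*2) (m*n/n≡m (p / 2) 2))))
      where
      n≡[p/2]*2 : n ≡ p / 2 * 2
      n≡[p/2]*2 = cong (_∸ 1) (trans (m≡m%n+[m/n]*n p 2) (cong (_+ p / 2 * 2) p%2≡1))

    0<h : 0 < h
    0<h with h | n≡h*2
    ... | zero | n≡0 = ⊥-elim (<-irrefl refl (subst (0 <_) n≡0 (>-nonZero⁻¹ n)))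
    ... | suc _ | _ = z<s

    h<n : h < n
    h<n = subst (h <_) (sym n≡h*2) (m<m*n h 2 {{>-nonZero 0<h}} (s≤s (s≤s z≤n)))

    g^h*g^h≈1 : g ^ h * g ^ h ≈ 1
    g^h*g^h≈1 = trans (cong (_% p) (sym (g^-+ h h)))
      (trans (cong (λ k → g ^ k % p) (trans (solve 1 (λ h → h :+ h := h :* con 2) refl h) (sym n≡h*2))) fermat)

    1+g^h≈0 : 1 + g ^ h ≈ 0
    1+g^h≈0 with euclidsLemma (1 + g ^ h) (g ^ h ∸ 1) isPrime
      (subst (p ∣_) (sym ([1+m]*[m∸1]≡m*m∸1 (g ^ h))) (≈⇒∣∸ (*-mono-≤ (1≤g^ h) (1≤g^ h)) g^h*g^h≈1))
    ... | inj₁ p∣1+g^h = ∣⇒≈0 p∣1+g^h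
    ... | inj₂ p∣g^h∸1 = ⊥-elim (g^≉1 0<h h<n (∣∸⇒≈ (1≤g^ h) p∣g^h∸1))

    g^k+g^[k+h]≈0 : ∀ k → g ^ k + g ^ (k + h) ≈ 0
    g^k+g^[k+h]≈0 k = begin
        (g ^ k + g ^ (k + h)) % p
      ≡⟨ cong (_% p) (cong₂ _+_ (sym (*-identityʳ (g ^ k))) (g^-+ k h)) ⟩
        (g ^ k * 1 + g ^ k * g ^ h) % p
      ≡⟨ cong (_% p) (sym (*-distribˡ-+ (g ^ k) 1 (g ^ h))) ⟩
        g ^ k * (1 + g ^ h) % p
      ≡⟨ ≈-*ˡ (g ^ k) 1+g^h≈0 ⟩
        g ^ k * 0 % p
      ≡⟨ cong (_% p) (*-zeroʳ (g ^ k)) ⟩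
        0 % p
      ∎
      where open ≡-Reasoning

    g^k+x≈0⇔x≈g^[k+h] : ∀ k x → (g ^ k + x ≈ 0) ⇔ (x ≈ g ^ (k + h))
    g^k+x≈0⇔x≈g^[k+h] k x = mk⇔
      (λ g^k+x≈0 → ≈-cancelˡ-+ (g ^ k) (trans g^k+x≈0 (sym (g^k+g^[k+h]≈0 k))))
      (λ x≈g^[k+h] → trans (≈-+ {g ^ k} refl x≈g^[k+h]) (g^k+g^[k+h]≈0 k))

module Divisor {n d : ℕ} .{{_ : NonZero n}} .{{_ : NonZero d}} (d∣n : d ∣ n) where

  e : ℕ
  e = n / d

  n≡e*d : n ≡ e * d
  n≡e*d = sym (m/n*n≡m d∣n)

  c+[qe+r]d≡c+rd+qn : ∀ c q r → c + (q * e + r) * d ≡ (c + r * d) + q * n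
  c+[qe+r]d≡c+rd+qn c q r = trans
    (solve 5 (λ c q e r d → c :+ (q :* e :+ r) :* d := (c :+ r :* d) :+ q :* (e :* d)) refl c q e r d)
    (cong (λ x → (c + r * d) + q * x) (sym n≡e*d))

  [c+rd]%n≡c+rd : ∀ {c r} → c < d → r < e → (c + r * d) % n ≡ c + r * d
  [c+rd]%n≡c+rd {c} {r} c<d r<e =
    m<n⇒m%n≡m (subst (c + r * d <_) (sym n≡e*d) (≤-trans (+-monoˡ-< (r * d) c<d) (*-monoˡ-≤ d r<e)))

  ∑-≡ᵇc+rd : ∀ {m c} → m < n → c < d → ∑[ r < e ] ⟦ m ≡ᵇ c + r * d ⟧ ≡ ⟦ m % d ≡ᵇ c ⟧
  ∑-≡ᵇc+rd {m} {c} m<n c<d with m % d ≟ c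
  ... | yes m%d≡c = begin
      ∑[ r < e ] ⟦ m ≡ᵇ c + r * d ⟧
    ≡⟨ ∑-cong e (λ r _ → cong ⟦_⟧ (≡ᵇ-cong (mk⇔ to (from r)))) ⟩
      ∑[ r < e ] ⟦ m / d ≡ᵇ r ⟧
    ≡⟨ ∑-count-≡ e (m / d) (m<n*o⇒m/o<n (subst (m <_) n≡e*d m<n)) ⟩
      1
    ≡⟨ cong ⟦_⟧ (sym (≡ᵇ-true m%d≡c)) ⟩
      ⟦ m % d ≡ᵇ c ⟧
    ∎
    where
    open ≡-Reasoning
    m≡c+[m/d]d : m ≡ c + m / d * d
    m≡c+[m/d]d = trans (m≡m%n+[m/n]*n m d) (cong (_+ m / d * d) m%d≡c)
    to : ∀ {r} → m ≡ c + r * d → m / d ≡ r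
    to {r} m≡c+rd = *-cancelʳ-≡ (m / d) r d (+-cancelˡ-≡ c _ _ (trans (sym m≡c+[m/d]d) m≡c+rd))
    from : ∀ r → m / d ≡ r → m ≡ c + r * d
    from r m/d≡r = trans m≡c+[m/d]d (cong (λ x → c + x * d) m/d≡r)
  ... | no m%d≢c = trans
    (∑-zero e (λ r _ → cong ⟦_⟧ (≡ᵇ-false (λ m≡c+rd → m%d≢c
      (trans (cong (_% d) m≡c+rd) (trans ([m+kn]%n≡m%n c r d) (m<n⇒m%n≡m c<d)))))))
    (cong ⟦_⟧ (sym (≡ᵇ-false m%d≢c)))

  ∑-≡ᵇ[c+td]%n : ∀ {m c} → m < n → c < d → ∑[ t < n ] ⟦ m ≡ᵇ (c + t * d) % n ⟧ ≡ d * ⟦ m % d ≡ᵇ c ⟧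
  ∑-≡ᵇ[c+td]%n {m} {c} m<n c<d = begin
      ∑[ t < n ] ⟦ m ≡ᵇ (c + t * d) % n ⟧
    ≡⟨ cong (λ x → ∑[ t < x ] ⟦ m ≡ᵇ (c + t * d) % n ⟧) (trans n≡e*d (*-comm e d)) ⟩
      ∑[ t < d * e ] ⟦ m ≡ᵇ (c + t * d) % n ⟧
    ≡⟨ ∑-split-* d e _ ⟩
      ∑[ q < d ] ∑[ r < e ] ⟦ m ≡ᵇ (c + (q * e + r) * d) % n ⟧
    ≡⟨ ∑-cong d (λ q _ → ∑-cong e (λ r r<e → cong (λ x → ⟦ m ≡ᵇ x ⟧)
         (trans (cong (_% n) (c+[qe+r]d≡c+rd+qn c q r))
                (trans ([m+kn]%n≡m%n (c + r * d) q n) ([c+rd]%n≡c+rd c<d r<e))))) ⟩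
      ∑[ q < d ] ∑[ r < e ] ⟦ m ≡ᵇ c + r * d ⟧
    ≡⟨ ∑-cong d (λ q _ → ∑-≡ᵇc+rd m<n c<d) ⟩
      ∑[ q < d ] ⟦ m % d ≡ᵇ c ⟧
    ≡⟨ ∑-const d _ ⟩
      d * ⟦ m % d ≡ᵇ c ⟧
    ∎
    where open ≡-Reasoning

  -- Both sides equal d * ∑[ r < n / d ] F (r * d).
  ∑-multiples : ∀ (F : ℕ → ℕ) → Periodic n F →
                ∑[ s < n ] F (s * d) ≡ d * ∑[ s < n ] (⟦ s % d ≡ᵇ 0 ⟧ * F s)
  ∑-multiples F per = begin
      ∑[ s < n ] F (s * d)
    ≡⟨ cong (λ x → ∑[ s < x ] F (s * d)) (trans n≡e*d (*-comm e d)) ⟩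
      ∑[ s < d * e ] F (s * d)
    ≡⟨ ∑-split-* d e _ ⟩
      ∑[ q < d ] ∑[ r < e ] F ((q * e + r) * d)
    ≡⟨ ∑-cong d (λ q _ → ∑-cong e (λ r _ → trans (cong F (c+[qe+r]d≡c+rd+qn 0 q r)) (periodic-* per (r * d) q))) ⟩
      ∑[ q < d ] ∑[ r < e ] F (r * d)
    ≡⟨ ∑-const d _ ⟩
      d * ∑[ r < e ] F (r * d)
    ≡⟨ cong (d *_) (∑-cong e (λ q _ → sym (block q))) ⟩
      d * ∑[ q < e ] ∑[ r < d ] (⟦ (q * d + r) % d ≡ᵇ 0 ⟧ * F (q * d + r))
    ≡⟨ cong (d *_) (sym (∑-split-* e d _)) ⟩
      d * ∑[ s < e * d ] (⟦ s % d ≡ᵇ 0 ⟧ * F s)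
    ≡⟨ cong (λ x → d * ∑[ s < x ] (⟦ s % d ≡ᵇ 0 ⟧ * F s)) (sym n≡e*d) ⟩
      d * ∑[ s < n ] (⟦ s % d ≡ᵇ 0 ⟧ * F s)
    ∎
    where
    open ≡-Reasoning
    block : ∀ q → ∑[ r < d ] (⟦ (q * d + r) % d ≡ᵇ 0 ⟧ * F (q * d + r)) ≡ F (q * d)
    block q = begin
        ∑[ r < d ] (⟦ (q * d + r) % d ≡ᵇ 0 ⟧ * F (q * d + r))
      ≡⟨ ∑-cong d (λ r r<d → cong (λ x → ⟦ x ≡ᵇ 0 ⟧ * F (q * d + r))
           (trans (cong (_% d) (+-comm (q * d) r)) (trans ([m+kn]%n≡m%n r q d) (m<n⇒m%n≡m r<d)))) ⟩
        ∑[ r < d ] (⟦ r ≡ᵇ 0 ⟧ * F (q * d + r))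
      ≡⟨ ∑-cong d (λ r _ → cong (λ b → ⟦ b ⟧ * F (q * d + r)) (≡ᵇ-sym r 0)) ⟩
        ∑[ r < d ] (⟦ 0 ≡ᵇ r ⟧ * F (q * d + r))
      ≡⟨ ∑-select d 0 _ (>-nonZero⁻¹ d) ⟩
        F (q * d + 0)
      ≡⟨ cong F (+-identityʳ (q * d)) ⟩
        F (q * d)
      ∎

module DthPowers (p : ℕ) .{{_ : NonZero p}} (isPrime : Prime p) (g : ℕ) (isPrimitiveRoot : IsPrimitiveRoot p g)
                 (d : ℕ) .{{_ : NonZero d}} (d∣n : d ∣ p ∸ 1) where

  open Congruence p
  open PrimitiveRoot p isPrime g isPrimitiveRoot
  open Divisor d∣n

  d≤n : d ≤ n
  d≤n = ∣⇒≤ d∣n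

  g^c*[g^t%p]^d≈g^[c+td] : ∀ c t → g ^ c * (g ^ t % p) ^ d ≈ g ^ (c + t * d)
  g^c*[g^t%p]^d≈g^[c+td] c t = begin
      g ^ c * (g ^ t % p) ^ d % p
    ≡⟨ ≈-*ˡ (g ^ c) (≈-^ d (%-≈ (g ^ t))) ⟩
      g ^ c * (g ^ t) ^ d % p
    ≡⟨ cong (λ x → g ^ c * x % p) (^-*-assoc g t d) ⟩
      g ^ c * g ^ (t * d) % p
    ≡⟨ cong (_% p) (sym (g^-+ c (t * d))) ⟩
      g ^ (c + t * d) % p
    ∎
    where open ≡-Reasoning

  T-inΓ : ∀ a → T (inΓ p g d a) ⇔ (∃[ k ] k < p × a ≡ g ^ (d * k) % p)
  T-inΓ a = mk⇔ to from
    where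
    to : T (inΓ p g d a) → ∃[ k ] k < p × a ≡ g ^ (d * k) % p
    to a∈Γ with applyUpTo⁻ id (any⁻ _ (upTo p) a∈Γ)
    ... | k , k<p , a≡ᵇ = k , k<p , trans (≡ᵇ⇒≡ a _ a≡ᵇ) (cong (_% p) (^-*-assoc g d k))
    from : ∃[ k ] k < p × a ≡ g ^ (d * k) % p → T (inΓ p g d a)
    from (k , k<p , a≡) =
      any⁺ _ (applyUpTo⁺ id (≡⇒≡ᵇ a _ (trans a≡ (cong (_% p) (sym (^-*-assoc g d k))))) k<p)

  inΓ-0 : inΓ p g d 0 ≡ false
  inΓ-0 = T-injective (mk⇔ 0∉Γ λ ())
    where
    0∉Γ : T (inΓ p g d 0) → T false
    0∉Γ 0∈Γ with Equivalence.to (T-inΓ 0) 0∈Γ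
    ... | k , _ , 0≡g^dk = g^≉0 (d * k) (trans (sym 0≡g^dk) (sym (m*n%n≡0 0 p)))

  inΓ-g^ : ∀ {s} → s < n → inΓ p g d (g ^ s % p) ≡ (s % d ≡ᵇ 0)
  inΓ-g^ {s} s<n = T-injective (mk⇔ to from)
    where
    to : T (inΓ p g d (g ^ s % p)) → T (s % d ≡ᵇ 0)
    to g^s∈Γ with Equivalence.to (T-inΓ _) g^s∈Γ
    ... | k , _ , g^s≈g^dk = ≡⇒≡ᵇ _ 0 (begin
        s % d
      ≡⟨ sym (m∣n⇒o%n%m≡o%m d n s d∣n) ⟩
        s % n % d
      ≡⟨ cong (_% d) (Equivalence.to (g^≈g^⇔%≡ s (d * k)) g^s≈g^dk) ⟩
        d * k % n % d
      ≡⟨ m∣n⇒o%n%m≡o%m d n (d * k) d∣n ⟩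
        d * k % d
      ≡⟨ cong (_% d) (*-comm d k) ⟩
        k * d % d
      ≡⟨ m*n%n≡0 k d ⟩
        0
      ∎)
      where open ≡-Reasoning
    from : T (s % d ≡ᵇ 0) → T (inΓ p g d (g ^ s % p))
    from s%d≡ᵇ0 = Equivalence.from (T-inΓ _)
      ( s / d
      , ≤-<-trans (m/n≤m s d) (<-trans s<n (subst (n <_) (sym p≡1+n) ≤-refl))
      , cong (λ x → g ^ x % p) (sym (m*[n/m]≡n (m%n≡0⇒n∣m s d (≡ᵇ⇒≡ _ 0 s%d≡ᵇ0)))))

  ∑-y≈ᵇg^c*z^d : ∀ {a c} y → y ≈ g ^ a → a < d → c < d → ∑[ z < p ] ⟦ y ≈ᵇ g ^ c * z ^ d ⟧ ≡ d * δ a c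
  ∑-y≈ᵇg^c*z^d {a} {c} y y≈g^a a<d c<d = begin
      ∑[ z < p ] ⟦ y ≈ᵇ g ^ c * z ^ d ⟧
    ≡⟨ ∑-units _ ⟩
      ⟦ y ≈ᵇ g ^ c * 0 ^ d ⟧ + ∑[ t < n ] ⟦ y ≈ᵇ g ^ c * (g ^ t % p) ^ d ⟧
    ≡⟨ cong₂ _+_ (cong ⟦_⟧ (≡ᵇ-false y≉g^c*0^d)) (∑-cong n (λ t _ → cong ⟦_⟧ (term t))) ⟩
      ∑[ t < n ] ⟦ a ≡ᵇ (c + t * d) % n ⟧
    ≡⟨ ∑-≡ᵇ[c+td]%n a<n c<d ⟩
      d * ⟦ a % d ≡ᵇ c ⟧
    ≡⟨ cong (λ x → d * ⟦ x ≡ᵇ c ⟧) (m<n⇒m%n≡m a<d) ⟩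
      d * δ a c
    ∎
    where
    open ≡-Reasoning
    a<n : a < n
    a<n = <-≤-trans a<d d≤n
    y≉g^c*0^d : ¬ y ≈ g ^ c * 0 ^ d
    y≉g^c*0^d y≈0 = g^≉0 a (trans (sym y≈g^a) (trans y≈0 (trans (cong (λ x → g ^ c * x % p) (0^n≡0 d)) (cong (_% p) (*-zeroʳ (g ^ c))))))
    term : ∀ t → (y ≈ᵇ g ^ c * (g ^ t % p) ^ d) ≡ (a ≡ᵇ (c + t * d) % n)
    term t = begin
        y ≈ᵇ g ^ c * (g ^ t % p) ^ d
      ≡⟨ ≈ᵇ-cong y≈g^a (g^c*[g^t%p]^d≈g^[c+td] c t) ⟩
        g ^ a ≈ᵇ g ^ (c + t * d)
      ≡⟨ ≡ᵇ-cong (g^≈g^⇔%≡ a (c + t * d)) ⟩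
        a % n ≡ᵇ (c + t * d) % n
      ≡⟨ cong (_≡ᵇ (c + t * d) % n) (m<n⇒m%n≡m a<n) ⟩
        a ≡ᵇ (c + t * d) % n
      ∎

  ∑-Γ : ∀ (F : ℕ → ℕ) → ∑[ a < p ] (⟦ inΓ p g d a ⟧ * F a) ≡ ∑[ s < n ] (⟦ s % d ≡ᵇ 0 ⟧ * F (g ^ s % p))
  ∑-Γ F = begin
      ∑[ a < p ] (⟦ inΓ p g d a ⟧ * F a)
    ≡⟨ ∑-units _ ⟩
      ⟦ inΓ p g d 0 ⟧ * F 0 + ∑[ s < n ] (⟦ inΓ p g d (g ^ s % p) ⟧ * F (g ^ s % p))
    ≡⟨ cong₂ _+_ (cong (λ b → ⟦ b ⟧ * F 0) inΓ-0)
                 (∑-cong n (λ s s<n → cong (λ b → ⟦ b ⟧ * F (g ^ s % p)) (inΓ-g^ s<n))) ⟩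
      ∑[ s < n ] (⟦ s % d ≡ᵇ 0 ⟧ * F (g ^ s % p))
    ∎
    where open ≡-Reasoning

  g^[a+[t+n]d]≈g^[a+td] : ∀ a t → g ^ (a + (t + n) * d) ≈ g ^ (a + t * d)
  g^[a+[t+n]d]≈g^[a+td] a t = trans
    (cong (λ k → g ^ k % p) (solve 4 (λ a t n d → a :+ (t :+ n) :* d := (a :+ t :* d) :+ d :* n) refl a t n d))
    (g^[a+qn]≈g^a (a + t * d) d)

-- Points on the curve

module Curve (p : ℕ) .{{_ : NonZero p}} (isPrime : Prime p) (p≢2 : p ≢ 2)
             (g : ℕ) (isPrimitiveRoot : IsPrimitiveRoot p g)
             (d : ℕ) .{{_ : NonZero d}} (d∣n : d ∣ p ∸ 1)
             {i j l : ℕ} (i<d : i < d) (j<d : j < d) (l<d : l < d) where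

  open Congruence p
  open PrimitiveRoot p isPrime g isPrimitiveRoot
  open HalfOrder p≢2
  open Divisor d∣n
  open DthPowers p isPrime g isPrimitiveRoot d d∣n

  onCurve : ℕ → ℕ → ℕ → Bool
  onCurve x y z = g ^ i * x ^ d + g ^ j * y ^ d ≈ᵇ g ^ l * z ^ d

  torusTerm : ℕ → ℕ → ℕ
  torusTerm s t = ⟦ g ^ i + g ^ (j + s * d) ≈ᵇ g ^ (l + t * d) ⟧

  torusCount : ℕ
  torusCount = ∑[ s < n ] ∑[ t < n ] torusTerm s t

  m*0^d≡0 : ∀ m → m * 0 ^ d ≡ 0
  m*0^d≡0 m = trans (cong (m *_) (0^n≡0 d)) (*-zeroʳ m)

  m*1^d≡m : ∀ m → m * 1 ^ d ≡ m
  m*1^d≡m m = trans (cong (m *_) (^-zeroˡ d)) (*-identityʳ m)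

  -- The normalised representatives of P²(F_p) are (0:0:1), (0:1:z) and (1:y:z).
  N₀₀₁ N₀₁ N₁ : ℕ
  N₀₀₁ = ⟦ onCurve 0 0 1 ⟧
  N₀₁ = ∑[ z < p ] ⟦ onCurve 0 1 z ⟧
  N₁ = ∑[ y < p ] ∑[ z < p ] ⟦ onCurve 1 y z ⟧

  MCount≡ : MCount p g d i j l ≡ (N₀₀₁ + N₀₁) + N₁
  MCount≡ = begin
      MCount p g d i j l
    ≡⟨ count-cartesianProduct _ id p _ ⟩
      ∑[ x < p ] count _ (cartesianProduct (upTo p) (upTo p))
    ≡⟨ ∑-cong p (λ x _ → trans (count-cartesianProduct _ id p _) (∑-cong p (λ y _ → count-applyUpTo _ id p))) ⟩
      ∑[ x < p ] ∑[ y < p ] ∑[ z < p ] ⟦ isNormalized (x , y , z) ∧ onCurve x y z ⟧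
    ≡⟨ ∑-first-two _ 1<p (λ _ → ∑-zero p (λ _ _ → ∑-zero p (λ _ _ → refl))) ⟩
      ∑[ y < p ] ∑[ z < p ] ⟦ isNormalized (0 , y , z) ∧ onCurve 0 y z ⟧ + N₁
    ≡⟨ cong (_+ N₁) (∑-first-two _ 1<p (λ _ → ∑-zero p (λ _ _ → refl))) ⟩
      (∑[ z < p ] ⟦ isNormalized (0 , 0 , z) ∧ onCurve 0 0 z ⟧ + N₀₁) + N₁
    ≡⟨ cong (λ x → (x + N₀₁) + N₁) (∑-first-two _ 1<p (λ _ → refl)) ⟩
      (N₀₀₁ + N₀₁) + N₁
    ∎
    where open ≡-Reasoning

  N₀₀₁≡0 : N₀₀₁ ≡ 0
  N₀₀₁≡0 = cong ⟦_⟧ (≡ᵇ-false (λ 0≈g^l → g^≉0 l (sym (begin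
      0 % p
    ≡⟨ cong (_% p) (sym (cong₂ _+_ (m*0^d≡0 (g ^ i)) (m*0^d≡0 (g ^ j)))) ⟩
      (g ^ i * 0 ^ d + g ^ j * 0 ^ d) % p
    ≡⟨ 0≈g^l ⟩
      g ^ l * 1 ^ d % p
    ≡⟨ cong (_% p) (m*1^d≡m (g ^ l)) ⟩
      g ^ l % p
    ∎))))
    where open ≡-Reasoning

  N₀₁≡dδ : N₀₁ ≡ d * δ j l
  N₀₁≡dδ = ∑-y≈ᵇg^c*z^d _ (cong (_% p) (cong₂ _+_ (m*0^d≡0 (g ^ i)) (m*1^d≡m (g ^ j)))) j<d l<d

  δ*≡ : ⟦ (i + h) % n % d ≡ᵇ j ⟧ ≡ δ* p d i j
  δ*≡ = cong ⟦_⟧ (trans (cong (_≡ᵇ j) (m∣n⇒o%n%m≡o%m d n (i + h) d∣n))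
                        (≡ᵇ-cong (mk⇔ (swap i<d) (λ eq → trans (cong (_% d) (+-comm i h))
                                                        (swap j<d (trans (cong (_% d) (+-comm j h)) eq))))))
    where
    d∣h+h : d ∣ h + h
    d∣h+h = subst (d ∣_) (trans n≡h*2 (solve 1 (λ h → h :* con 2 := h :+ h) refl h)) d∣n
    swap : ∀ {a b} → a < d → (a + h) % d ≡ b → (h + b) % d ≡ a
    swap = [a+h]%d≡b⇒[h+b]%d≡a d∣h+h

  ∑-g^i+g^[j+sd]≈ᵇ0 : ∑[ s < n ] ⟦ g ^ i + g ^ (j + s * d) ≈ᵇ 0 ⟧ ≡ d * δ* p d i j
  ∑-g^i+g^[j+sd]≈ᵇ0 = begin
      ∑[ s < n ] ⟦ g ^ i + g ^ (j + s * d) ≈ᵇ 0 ⟧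
    ≡⟨ ∑-cong n (λ s _ → cong ⟦_⟧ (term s)) ⟩
      ∑[ s < n ] ⟦ (i + h) % n ≡ᵇ (j + s * d) % n ⟧
    ≡⟨ ∑-≡ᵇ[c+td]%n (m%n<n (i + h) n) j<d ⟩
      d * ⟦ (i + h) % n % d ≡ᵇ j ⟧
    ≡⟨ cong (d *_) δ*≡ ⟩
      d * δ* p d i j
    ∎
    where
    open ≡-Reasoning
    term : ∀ s → (g ^ i + g ^ (j + s * d) ≈ᵇ 0) ≡ ((i + h) % n ≡ᵇ (j + s * d) % n)
    term s = begin
        g ^ i + g ^ (j + s * d) ≈ᵇ 0
      ≡⟨ ≡ᵇ-cong (g^k+x≈0⇔x≈g^[k+h] i (g ^ (j + s * d))) ⟩
        g ^ (j + s * d) ≈ᵇ g ^ (i + h)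
      ≡⟨ ≡ᵇ-cong (g^≈g^⇔%≡ (j + s * d) (i + h)) ⟩
        (j + s * d) % n ≡ᵇ (i + h) % n
      ≡⟨ ≡ᵇ-sym ((j + s * d) % n) ((i + h) % n) ⟩
        (i + h) % n ≡ᵇ (j + s * d) % n
      ∎

  N₁≡ : N₁ ≡ d * δ i l + (d * δ* p d i j + torusCount)
  N₁≡ = begin
      ∑[ y < p ] ∑[ z < p ] ⟦ onCurve 1 y z ⟧
    ≡⟨ ∑-units _ ⟩
      ∑[ z < p ] ⟦ onCurve 1 0 z ⟧ + ∑[ s < n ] ∑[ z < p ] ⟦ onCurve 1 (g ^ s % p) z ⟧
    ≡⟨ cong₂ _+_ (∑-y≈ᵇg^c*z^d _ g^i*1^d+g^j*0^d≈g^i i<d l<d) (∑-cong n (λ s _ → ∑-units _)) ⟩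
      d * δ i l + ∑[ s < n ] (⟦ onCurve 1 (g ^ s % p) 0 ⟧ + ∑[ t < n ] ⟦ onCurve 1 (g ^ s % p) (g ^ t % p) ⟧)
    ≡⟨ cong (d * δ i l +_) (∑-distrib-+ n _ _) ⟩
      d * δ i l + (∑[ s < n ] ⟦ onCurve 1 (g ^ s % p) 0 ⟧
                   + ∑[ s < n ] ∑[ t < n ] ⟦ onCurve 1 (g ^ s % p) (g ^ t % p) ⟧)
    ≡⟨ cong (d * δ i l +_) (cong₂ _+_
         (trans (∑-cong n (λ s _ → cong ⟦_⟧ (≈ᵇ-cong (g^i*1^d+g^j*[g^s%p]^d≈ s) (cong (_% p) (m*0^d≡0 (g ^ l))))))
                ∑-g^i+g^[j+sd]≈ᵇ0)
         (∑-cong n (λ s _ → ∑-cong n (λ t _ → cong ⟦_⟧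
           (≈ᵇ-cong (g^i*1^d+g^j*[g^s%p]^d≈ s) (g^c*[g^t%p]^d≈g^[c+td] l t)))))) ⟩
      d * δ i l + (d * δ* p d i j + torusCount)
    ∎
    where
    open ≡-Reasoning
    g^i*1^d+g^j*0^d≈g^i : g ^ i * 1 ^ d + g ^ j * 0 ^ d ≈ g ^ i
    g^i*1^d+g^j*0^d≈g^i = cong (_% p) (trans (cong₂ _+_ (m*1^d≡m (g ^ i)) (m*0^d≡0 (g ^ j))) (+-identityʳ (g ^ i)))
    g^i*1^d+g^j*[g^s%p]^d≈ : ∀ s → g ^ i * 1 ^ d + g ^ j * (g ^ s % p) ^ d ≈ g ^ i + g ^ (j + s * d)
    g^i*1^d+g^j*[g^s%p]^d≈ s = ≈-+ (cong (_% p) (m*1^d≡m (g ^ i))) (g^c*[g^t%p]^d≈g^[c+td] j s)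

  solves : ℕ → ℕ → ℕ
  solves s t = ⟦ g ^ (i + s) + g ^ (j + t) ≈ᵇ g ^ l ⟧

  solves-periodicˡ : ∀ t → Periodic n (λ s → solves s t)
  solves-periodicˡ t s = cong ⟦_⟧ (≈ᵇ-cong
    (≈-+ (trans (cong (λ k → g ^ k % p) (sym (+-assoc i s n))) (g^[a+n]≈g^a (i + s))) refl) refl)

  solves-periodicʳ : ∀ s → Periodic n (solves s)
  solves-periodicʳ s t = cong ⟦_⟧ (≈ᵇ-cong
    (≈-+ {g ^ (i + s)} refl (trans (cong (λ k → g ^ k % p) (sym (+-assoc j t n))) (g^[a+n]≈g^a (j + t)))) refl)

  cCount≡ : cCount p g d i j l ≡ ∑[ s < n ] (⟦ s % d ≡ᵇ 0 ⟧ * ∑[ t < n ] (⟦ t % d ≡ᵇ 0 ⟧ * solves s t))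
  cCount≡ = begin
      cCount p g d i j l
    ≡⟨ count-cartesianProduct _ id p _ ⟩
      ∑[ a < p ] count _ (upTo p)
    ≡⟨ ∑-cong p (λ a _ → count-applyUpTo _ id p) ⟩
      ∑[ a < p ] ∑[ b < p ] ⟦ inΓ p g d a ∧ inΓ p g d b ∧ (g ^ i * a + g ^ j * b ≈ᵇ g ^ l) ⟧
    ≡⟨ ∑-cong p (λ a _ → trans (∑-cong p (λ b _ → trans (⟦∧⟧ (inΓ p g d a) _)
                                                         (cong (⟦ inΓ p g d a ⟧ *_) (⟦∧⟧ (inΓ p g d b) _))))
                                (∑-distribˡ-* p ⟦ inΓ p g d a ⟧ _)) ⟩
      ∑[ a < p ] (⟦ inΓ p g d a ⟧ * ∑[ b < p ] (⟦ inΓ p g d b ⟧ * ⟦ g ^ i * a + g ^ j * b ≈ᵇ g ^ l ⟧))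
    ≡⟨ ∑-Γ _ ⟩
      ∑[ s < n ] (⟦ s % d ≡ᵇ 0 ⟧ * ∑[ b < p ] (⟦ inΓ p g d b ⟧ * ⟦ g ^ i * (g ^ s % p) + g ^ j * b ≈ᵇ g ^ l ⟧))
    ≡⟨ ∑-cong n (λ s _ → cong (⟦ s % d ≡ᵇ 0 ⟧ *_) (∑-Γ _)) ⟩
      ∑[ s < n ] (⟦ s % d ≡ᵇ 0 ⟧ * ∑[ t < n ] (⟦ t % d ≡ᵇ 0 ⟧ *
        ⟦ g ^ i * (g ^ s % p) + g ^ j * (g ^ t % p) ≈ᵇ g ^ l ⟧))
    ≡⟨ ∑-cong n (λ s _ → cong (⟦ s % d ≡ᵇ 0 ⟧ *_) (∑-cong n (λ t _ → cong (λ b → ⟦ t % d ≡ᵇ 0 ⟧ * ⟦ b ⟧)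
         (≈ᵇ-cong (≈-+ (g^a*[g^b%p]≈g^[a+b] i s) (g^a*[g^b%p]≈g^[a+b] j t)) refl)))) ⟩
      ∑[ s < n ] (⟦ s % d ≡ᵇ 0 ⟧ * ∑[ t < n ] (⟦ t % d ≡ᵇ 0 ⟧ * solves s t))
    ∎
    where
    open ≡-Reasoning
    g^a*[g^b%p]≈g^[a+b] : ∀ a b → g ^ a * (g ^ b % p) ≈ g ^ (a + b)
    g^a*[g^b%p]≈g^[a+b] a b = trans (≈-*ˡ (g ^ a) (%-≈ (g ^ b))) (cong (_% p) (sym (g^-+ a b)))

  d²*cCount≡ : d ^ 2 * cCount p g d i j l ≡ ∑[ s < n ] ∑[ t < n ] solves (s * d) (t * d)
  d²*cCount≡ = sym (begin
      ∑[ s < n ] ∑[ t < n ] solves (s * d) (t * d)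
    ≡⟨ ∑-cong n (λ s _ → ∑-multiples (solves (s * d)) (solves-periodicʳ (s * d))) ⟩
      ∑[ s < n ] (d * ∑[ t < n ] (⟦ t % d ≡ᵇ 0 ⟧ * solves (s * d) t))
    ≡⟨ ∑-distribˡ-* n d _ ⟩
      d * ∑[ s < n ] ∑[ t < n ] (⟦ t % d ≡ᵇ 0 ⟧ * solves (s * d) t)
    ≡⟨ cong (d *_) (∑-multiples (λ s → ∑[ t < n ] (⟦ t % d ≡ᵇ 0 ⟧ * solves s t))
                                (λ s → ∑-cong n (λ t _ → cong (⟦ t % d ≡ᵇ 0 ⟧ *_) (solves-periodicˡ t s)))) ⟩
      d * (d * ∑[ s < n ] (⟦ s % d ≡ᵇ 0 ⟧ * ∑[ t < n ] (⟦ t % d ≡ᵇ 0 ⟧ * solves s t)))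
    ≡⟨ cong (λ x → d * (d * x)) (sym cCount≡) ⟩
      d * (d * cCount p g d i j l)
    ≡⟨ solve 2 (λ d c → d :* (d :* c) := (d :* (d :* con 1)) :* c) refl d (cCount p g d i j l) ⟩
      d ^ 2 * cCount p g d i j l
    ∎)
    where open ≡-Reasoning

  -- Multiply through by g^((n − s)d), the inverse of g^(sd).
  solves-rescale : ∀ s t → s ≤ n → solves (s * d) ((t + s) * d) ≡ torusTerm t (n ∸ s)
  solves-rescale s t s≤n = cong ⟦_⟧ (≡ᵇ-cong (mk⇔
    (λ X≈g^l → trans (sym g^u*X≈) (trans (≈-*ˡ (g ^ u) X≈g^l) (cong (_% p) g^u*g^l≡g^[l+u])))
    (λ X'≈g^[l+u] → g^-cancelˡ u
       (trans g^u*X≈ (trans X'≈g^[l+u] (cong (_% p) (sym g^u*g^l≡g^[l+u])))))))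
    where
    w u : ℕ
    w = n ∸ s
    u = w * d
    w+s≡n : w + s ≡ n
    w+s≡n = m∸n+n≡m s≤n
    g^u*X≈ : g ^ u * (g ^ (i + s * d) + g ^ (j + (t + s) * d)) ≈ g ^ i + g ^ (j + t * d)
    g^u*X≈ = trans
      (cong (_% p) (trans (*-distribˡ-+ (g ^ u) _ _) (cong₂ _+_ (sym (g^-+ u _)) (sym (g^-+ u _)))))
      (≈-+ (trans (cong (λ k → g ^ k % p)
                    (trans (solve 4 (λ w d i s → w :* d :+ (i :+ s :* d) := i :+ d :* (w :+ s)) refl w d i s)
                           (cong (λ x → i + d * x) w+s≡n)))
                  (g^[a+qn]≈g^a i d))
           (trans (cong (λ k → g ^ k % p)
                    (trans (solve 5 (λ w d j t s → w :* d :+ (j :+ (t :+ s) :* d) := (j :+ t :* d) :+ d :* (w :+ s))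
                                    refl w d j t s)
                           (cong (λ x → (j + t * d) + d * x) w+s≡n)))
                  (g^[a+qn]≈g^a (j + t * d) d)))
    g^u*g^l≡g^[l+u] : g ^ u * g ^ l ≡ g ^ (l + u)
    g^u*g^l≡g^[l+u] = trans (sym (g^-+ u l)) (cong (g ^_) (+-comm u l))

  ∑∑solves≡torusCount : ∑[ s < n ] ∑[ t < n ] solves (s * d) (t * d) ≡ torusCount
  ∑∑solves≡torusCount = begin
      ∑[ s < n ] ∑[ t < n ] solves (s * d) (t * d)
    ≡⟨ ∑-cong n (λ s _ → sym (∑-rotate n (λ t → solves (s * d) (t * d)) (λ t → cong ⟦_⟧
         (≈ᵇ-cong (≈-+ {g ^ (i + s * d)} refl (g^[a+[t+n]d]≈g^[a+td] j t)) refl)) s)) ⟩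
      ∑[ s < n ] ∑[ t < n ] solves (s * d) ((t + s) * d)
    ≡⟨ ∑-cong n (λ s s<n → ∑-cong n (λ t _ → solves-rescale s t (<⇒≤ s<n))) ⟩
      ∑[ s < n ] ∑[ t < n ] torusTerm t (n ∸ s)
    ≡⟨ ∑-comm n n _ ⟩
      ∑[ t < n ] ∑[ s < n ] torusTerm t (n ∸ s)
    ≡⟨ ∑-cong n (λ t _ → ∑-reflect n (torusTerm t) (λ u → cong ⟦_⟧
         (≈ᵇ-cong refl (g^[a+[t+n]d]≈g^[a+td] l u)))) ⟩
      torusCount
    ∎
    where open ≡-Reasoning

lemma2p4 : (p : ℕ) → .{{_ : NonZero p}} → Prime p → p ≢ 2 →
           (g : ℕ) → IsPrimitiveRoot p g →
           (d : ℕ) → .{{_ : NonZero d}} → d ∣ p ∸ 1 →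
           (i j l : ℕ) → i < d → j < d → l < d →
           MCount p g d i j l
             ≡ d ^ 2 * cCount p g d i j l + d * (δ j l + δ i l + δ* p d i j)
lemma2p4 p isPrime p≢2 g isPrimitiveRoot d d∣p-1 i j l i<d j<d l<d = begin
    MCount p g d i j l
  ≡⟨ MCount≡ ⟩
    (N₀₀₁ + N₀₁) + N₁
  ≡⟨ cong₂ _+_ (cong₂ _+_ N₀₀₁≡0 N₀₁≡dδ) N₁≡ ⟩
    (0 + d * δ j l) + (d * δ i l + (d * δ* p d i j + torusCount))
  ≡⟨ solve 5 (λ d x y z a → (con 0 :+ d :* x) :+ (d :* y :+ (d :* z :+ a)) := a :+ d :* (x :+ y :+ z))
             refl d (δ j l) (δ i l) (δ* p d i j) torusCount ⟩
    torusCount + d * (δ j l + δ i l + δ* p d i j)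
  ≡⟨ cong (_+ d * (δ j l + δ i l + δ* p d i j)) (sym (trans d²*cCount≡ ∑∑solves≡torusCount)) ⟩
    d ^ 2 * cCount p g d i j l + d * (δ j l + δ i l + δ* p d i j)
  ∎
  where
  open ≡-Reasoning
  open Curve p isPrime p≢2 g isPrimitiveRoot d d∣p-1 i<d j<d l<d
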